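{- Let $n\ge1$ and $r$ be integers with $1\le r\le n$. Then for every integer $m$ with $1\le m\le n-r+1$, $$\sum_{\ell=1}^m\left[{r\atop \ell}\right]\left[{n\atop r-\ell+m}\right]_r=\left[{n\atop m}\right],$$ and for every integer $m$ with $n-r+2\le m\le n$, $$\sum_{\ell=1}^{n+1-\max\{m,r\}}\left[{r\atop m-n+r-1+\ell}\right]\left[{n\atop n-\ell+1}\right]_r=\left[{n\atop m}\right].$$
   Context: $\left[{n\atop m}\right]$ denotes the unsigned Stirling number of the first kind (the number of permutations of $\{1,\dots,n\}$ with exactly $m$ cycles). For $r\ge0$, the unsigned $r$-Stirling number of the first kind $\left[{n\atop m}\right]_r$ is the number of permutations of $\{1,\dots,n\}$ with exactly $m$ cycles such that $1,\dots,r$ lie in distinct cycles. -}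

module Defs where

open import Data.Nat using (ℕ; zero; suc; _+_; _∸_; _≤ᵇ_; _<ᵇ_; _≡ᵇ_)
open import Data.Bool using (Bool; true; false; _∧_; _∨_; not)
open import Data.Fin using (Fin; toℕ)
open import Data.Fin.Properties using (_≟_)
open import Data.Vec using (Vec; []; _∷_; lookup)
open import Data.List using (List; []; _∷_; concatMap; map; allFin; upTo)
open import Data.Nat.ListAction using (sum)
open import Data.Bool.ListAction using (all; any)
open import Relation.Nullary.Decidable using (⌊_⌋)
open import Relation.Nullary using (does)

-- All functions Fin k → Fin n, represented as vectors (σ i = lookup σ i).
allVecs : (k n : ℕ) → List (Vec (Fin n) k)
allVecs zero    n = [] ∷ []
allVecs (suc k) n = concatMap (λ x → map (x ∷_) (allVecs k n)) (allFin n)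

-- Endofunctions of {0,…,n-1} (the set {1,…,n} shifted down by one).
Endo : ℕ → Set
Endo n = Vec (Fin n) n

_==_ : ∀ {n} → Fin n → Fin n → Bool
i == j = ⌊ i ≟ j ⌋

countB : ∀ {A : Set} → (A → Bool) → List A → ℕ
countB p []       = 0
countB p (x ∷ xs) with p x
... | true  = suc (countB p xs)
... | false = countB p xs

iter : ∀ {n} → Endo n → ℕ → Fin n → Fin n
iter σ zero    i = i
iter σ (suc k) i = lookup σ (iter σ k i)

-- σ is a permutation (injective, hence bijective on a finite set)
isPerm : ∀ {n} → Endo n → Bool
isPerm {n} σ = all (λ i → all (λ j → not (lookup σ i == lookup σ j) ∨ (i == j)) (allFin n)) (allFin n)

-- j lies in the cycle of i under σ  (j = σ^k(i) for some k < n; orbits have size ≤ n)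
sameCycle : ∀ {n} → Endo n → Fin n → Fin n → Bool
sameCycle {n} σ i j = any (λ k → iter σ k i == j) (upTo n)

cycleMin : ∀ {n} → Endo n → Fin n → Bool
cycleMin {n} σ i = all (λ k → toℕ i ≤ᵇ toℕ (iter σ k i)) (upTo n)

numCycles : ∀ {n} → Endo n → ℕ
numCycles {n} σ = countB (cycleMin σ) (allFin n)

-- the elements 1,…,r (here 0,…,r-1) lie in pairwise distinct cycles
firstDistinct : ∀ {n} → ℕ → Endo n → Bool
firstDistinct {n} r σ =
  all (λ i → all (λ j → not ((toℕ i <ᵇ toℕ j) ∧ (toℕ j <ᵇ r)) ∨ not (sameCycle σ i j)) (allFin n)) (allFin n)


stirling1 : ℕ → ℕ → ℕ
stirling1 n m = countB (λ σ → isPerm σ ∧ (numCycles σ ≡ᵇ m)) (allVecs n n)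

rStirling1 : ℕ → ℕ → ℕ → ℕ
rStirling1 r n m = countB (λ σ → isPerm σ ∧ (numCycles σ ≡ᵇ m) ∧ firstDistinct r σ) (allVecs n n)

sumFrom1 : ℕ → (ℕ → ℕ) → ℕ
sumFrom1 u f = sum (map (λ i → f (suc i)) (upTo u))

{-# OPTIONS --safe #-}
-- Inserting the largest element n into a permutation of {0, …, n-1}, either right after one of its n
-- points or as a new fixed point, is a bijection onto the permutations of {0, …, n}; it keeps 0, …, r-1
-- in distinct cycles (r ≤ n) and adds a cycle exactly in the fixed-point case. Hence
-- [n+1, m]_r = n [n, m]_r + [n, m-1]_r, with [r, m]_r = δ(r, m) and [n, m] = [n, m]_0. By this
-- recurrence, [r+d, ·] and the convolution of [r, ·] with k ↦ [r+d, k+r]_r agree for all d, and the two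
-- sums are this convolution with its vanishing terms dropped: [r, ℓ] = 0 for ℓ = 0 or ℓ > r, and
-- [r+d, k]_r = 0 for k > r+d.

module Submission where

open import Defs
open import Algebra.Properties.CommutativeSemigroup using (interchange)
open import Data.Bool using (Bool; true; false; _∧_; _∨_; not; T)
open import Data.Bool.ListAction using (all; any)
open import Data.Bool.Properties using (∧-zeroʳ; ∧-identityʳ; T-∧; T-≡)
open import Data.Empty using (⊥; ⊥-elim)
open import Data.Fin using (Fin; zero; suc; toℕ; fromℕ; inject₁; lower₁; punchOut)
open import Data.Fin.Properties
  using (_≟_; suc-injective; toℕ<n; inject₁-lower₁; toℕ-fromℕ; toℕ-inject₁; toℕ-injective; any?; pigeonhole; injective⇒≤; punchOut-injective)
open import Data.List using (List; []; _∷_; _++_; map; concatMap; allFin; upTo; applyUpTo; length)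
open import Data.List.Membership.Propositional using (lose)
open import Data.List.Membership.Propositional.Properties using (∈-allFin; ∈-upTo⁺; ∈-upTo⁻)
open import Data.List.Properties using (map-++; map-cong; map-∘; map-tabulate; length-tabulate)
import Data.List.Relation.Unary.All as All
open import Data.List.Relation.Unary.All.Properties using (all⁺; all⁻)
open import Data.List.Relation.Unary.Any using (satisfied)
open import Data.List.Relation.Unary.Any.Properties using (any⁺; any⁻)
open import Data.Maybe using (Maybe; just; nothing; is-nothing)
import Data.Maybe as Maybe
open import Data.Maybe.Properties using (just-injective)
open import Data.Nat using (ℕ; zero; suc; _+_; _*_; _∸_; _≤_; _<_; _⊔_; _⊓_; _≡ᵇ_; _≤ᵇ_; _<ᵇ_; z≤n; s≤s; s≤s⁻¹; z<s; s<s)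
open import Data.Nat.ListAction using (sum)
open import Data.Nat.ListAction.Properties using (sum-++)
open import Data.Nat.Properties hiding (_≟_; suc-injective)
open import Data.Nat.Solver using (module +-*-Solver)
open import Data.Product using (_×_; _,_; proj₁; proj₂; ∃; uncurry)
import Data.Product.Properties as Product
open import Data.Sum using (inj₁; inj₂)
open import Data.Unit using (tt)
open import Data.Vec using (Vec; []; _∷_; lookup)
import Data.Vec as Vec
import Data.Vec.Properties as Vec
open import Function using (_∘_; id; Equivalence)
open import Function.Definitions using (Injective)
open import Relation.Binary.Definitions using (DecidableEquality; tri<; tri≈; tri>)
open import Relation.Binary.PropositionalEquality
open import Relation.Nullary using (Dec; yes; no; ¬_)
open import Relation.Nullary.Decidable using (⌊_⌋; isYes≗does; dec-true; dec-false; ⌊⌋-map′; toWitness; fromWitness)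

open +-*-Solver using (solve; _:+_; _:*_; _:=_; con)
open ≡-Reasoning

indicator : Bool → ℕ
indicator true  = 1
indicator false = 0

T⇒≡true : ∀ {b} → T b → b ≡ true
T⇒≡true = Equivalence.to T-≡

¬T⇒≡false : ∀ {b} → ¬ T b → b ≡ false
¬T⇒≡false {false} _ = refl
¬T⇒≡false {true}  f = ⊥-elim (f tt)

T-extensional : ∀ {a b} → (T a → T b) → (T b → T a) → a ≡ b
T-extensional {false} {false} _ _ = refl
T-extensional {false} {true}  _ g = ⊥-elim (g tt)
T-extensional {true}  {false} f _ = ⊥-elim (f tt)
T-extensional {true}  {true}  _ _ = refl

T-implication⁻ : ∀ a b → T (not a ∨ b) → T a → T b
T-implication⁻ true _ h _ = h

T-implication⁺ : ∀ a b → (T a → T b) → T (not a ∨ b)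
T-implication⁺ true  _ f = f tt
T-implication⁺ false _ _ = tt

T-not⁻ : ∀ a → T (not a) → ¬ T a
T-not⁻ true h _ = h

T-not⁺ : ∀ a → ¬ T a → T (not a)
T-not⁺ true  f = f tt
T-not⁺ false _ = tt

⌊⌋-true : ∀ {P : Set} (d : Dec P) → P → ⌊ d ⌋ ≡ true
⌊⌋-true d p = trans (isYes≗does d) (dec-true d p)

⌊⌋-false : ∀ {P : Set} (d : Dec P) → ¬ P → ⌊ d ⌋ ≡ false
⌊⌋-false d ¬p = trans (isYes≗does d) (dec-false d ¬p)

all-allFin⁻ : ∀ {n} (p : Fin n → Bool) → T (all p (allFin n)) → ∀ i → T (p i)
all-allFin⁻ p h i = All.lookup (all⁺ p _ h) (∈-allFin i)

all-allFin⁺ : ∀ {n} (p : Fin n → Bool) → (∀ i → T (p i)) → T (all p (allFin n))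
all-allFin⁺ {n} p f = all⁻ p {allFin n} (All.tabulate (λ {i} _ → f i))

all-allFin²⁻ : ∀ {n} (p : Fin n → Fin n → Bool) → T (all (λ i → all (p i) (allFin n)) (allFin n)) →
  ∀ i j → T (p i j)
all-allFin²⁻ {n} p h i = all-allFin⁻ (p i) (all-allFin⁻ (λ i → all (p i) (allFin n)) h i)

all-allFin²⁺ : ∀ {n} (p : Fin n → Fin n → Bool) → (∀ i j → T (p i j)) →
  T (all (λ i → all (p i) (allFin n)) (allFin n))
all-allFin²⁺ {n} p f = all-allFin⁺ (λ i → all (p i) (allFin n)) λ i → all-allFin⁺ (p i) (f i)

all-upTo⁻ : ∀ {n} (p : ℕ → Bool) → T (all p (upTo n)) → ∀ {k} → k < n → T (p k)
all-upTo⁻ p h k<n = All.lookup (all⁺ p _ h) (∈-upTo⁺ k<n)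

all-upTo⁺ : ∀ {n} (p : ℕ → Bool) → (∀ {k} → k < n → T (p k)) → T (all p (upTo n))
all-upTo⁺ {n} p f = all⁻ p {upTo n} (All.tabulate (λ k∈ → f (∈-upTo⁻ k∈)))

any-upTo⁻ : ∀ {n} (p : ℕ → Bool) → T (any p (upTo n)) → ∃ λ k → T (p k)
any-upTo⁻ {n} p h = satisfied (any⁻ p (upTo n) h)

any-upTo⁺ : ∀ {n k} (p : ℕ → Bool) → k < n → T (p k) → T (any p (upTo n))
any-upTo⁺ p k<n pk = any⁺ p (lose (∈-upTo⁺ k<n) pk)

-- Counting

countB≡sum : ∀ {A : Set} (p : A → Bool) xs → countB p xs ≡ sum (map (indicator ∘ p) xs)
countB≡sum p []       = refl
countB≡sum p (x ∷ xs) with p x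
... | true  = cong suc (countB≡sum p xs)
... | false = countB≡sum p xs

countB-cong : ∀ {A : Set} {p q : A → Bool} xs → (∀ x → p x ≡ q x) → countB p xs ≡ countB q xs
countB-cong {p = p} {q} xs p≗q = begin
  countB p xs                  ≡⟨ countB≡sum p xs ⟩
  sum (map (indicator ∘ p) xs) ≡⟨ cong sum (map-cong (cong indicator ∘ p≗q) xs) ⟩
  sum (map (indicator ∘ q) xs) ≡⟨ countB≡sum q xs ⟨
  countB q xs                  ∎

countB-false : ∀ {A : Set} (p : A → Bool) xs → (∀ x → p x ≡ false) → countB p xs ≡ 0
countB-false p []       _ = refl
countB-false p (x ∷ xs) h rewrite h x = countB-false p xs h

countB-true : ∀ {A : Set} (p : A → Bool) xs → (∀ x → p x ≡ true) → countB p xs ≡ length xs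
countB-true p []       _ = refl
countB-true p (x ∷ xs) h rewrite h x = cong suc (countB-true p xs h)

countB-map : ∀ {A B : Set} (p : B → Bool) (f : A → B) xs → countB p (map f xs) ≡ countB (p ∘ f) xs
countB-map p f []       = refl
countB-map p f (x ∷ xs) with p (f x)
... | true  = cong suc (countB-map p f xs)
... | false = countB-map p f xs

countB-const-∧ : ∀ {A : Set} c (p : A → Bool) xs → countB (λ x → c ∧ p x) xs ≡ indicator c * countB p xs
countB-const-∧ true  p xs = sym (+-identityʳ _)
countB-const-∧ false p xs = countB-false _ xs (λ _ → refl)

sum-map-zero : ∀ {A : Set} (xs : List A) → sum (map (λ _ → 0) xs) ≡ 0
sum-map-zero []       = refl
sum-map-zero (_ ∷ xs) = sum-map-zero xs

sum-map-+ : ∀ {A : Set} (f g : A → ℕ) xs → sum (map (λ x → f x + g x) xs) ≡ sum (map f xs) + sum (map g xs)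
sum-map-+ f g []       = refl
sum-map-+ f g (x ∷ xs) =
  trans (cong (f x + g x +_) (sum-map-+ f g xs)) (interchange +-commutativeSemigroup (f x) (g x) _ _)

sum-map-swap : ∀ {A B : Set} (h : A → B → ℕ) xs ys →
  sum (map (λ x → sum (map (h x) ys)) xs) ≡ sum (map (λ y → sum (map (λ x → h x y) xs)) ys)
sum-map-swap h []       ys = sym (sum-map-zero ys)
sum-map-swap h (x ∷ xs) ys =
  trans (cong (sum (map (h x) ys) +_) (sum-map-swap h xs ys)) (sym (sum-map-+ (h x) _ ys))

sum-map-concatMap : ∀ {A B : Set} (h : B → ℕ) (f : A → List B) xs →
  sum (map h (concatMap f xs)) ≡ sum (map (λ x → sum (map h (f x))) xs)
sum-map-concatMap h f []       = refl
sum-map-concatMap h f (x ∷ xs) = begin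
  sum (map h (f x ++ concatMap f xs))              ≡⟨ cong sum (map-++ h (f x) _) ⟩
  sum (map h (f x) ++ map h (concatMap f xs))      ≡⟨ sum-++ (map h (f x)) _ ⟩
  sum (map h (f x)) + sum (map h (concatMap f xs)) ≡⟨ cong (sum (map h (f x)) +_) (sum-map-concatMap h f xs) ⟩
  sum (map (λ x → sum (map h (f x))) (x ∷ xs))     ∎

countB-concatMap-map : ∀ {A B C : Set} (p : C → Bool) (h : A → B → C) xs ys →
  countB p (concatMap (λ x → map (h x) ys) xs) ≡ sum (map (λ x → countB (p ∘ h x) ys) xs)
countB-concatMap-map p h xs ys = begin
  countB p (concatMap (λ x → map (h x) ys) xs)
    ≡⟨ countB≡sum p (concatMap (λ x → map (h x) ys) xs) ⟩
  sum (map (indicator ∘ p) (concatMap (λ x → map (h x) ys) xs))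
    ≡⟨ sum-map-concatMap (indicator ∘ p) _ xs ⟩
  sum (map (λ x → sum (map (indicator ∘ p) (map (h x) ys))) xs)
    ≡⟨ cong sum (map-cong (λ x → trans (cong sum (sym (map-∘ ys))) (sym (countB≡sum _ ys))) xs) ⟩
  sum (map (λ x → countB (p ∘ h x) ys) xs)
    ∎

record Enumerates {A : Set} (eq? : DecidableEquality A) (xs : List A) : Set where
  constructor occurring-once
  field occurs-once : ∀ a → countB (λ x → ⌊ eq? x a ⌋) xs ≡ 1

open Enumerates

countB-∧-≟ : ∀ {A : Set} {eq? : DecidableEquality A} {xs} → Enumerates eq? xs →
  ∀ c a → countB (λ x → c ∧ ⌊ eq? x a ⌋) xs ≡ indicator c
countB-∧-≟ {xs = xs} enum c a =
  trans (countB-const-∧ c _ xs) (trans (cong (indicator c *_) (occurs-once enum a)) (*-identityʳ _))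

countB-unique : ∀ {A : Set} {eq? : DecidableEquality A} {xs} → Enumerates eq? xs →
  (p : A → Bool) (a : A) → (∀ x → T (p x) → x ≡ a) → countB p xs ≡ indicator (p a)
countB-unique {eq? = eq?} {xs} enum p a only-a = trans (countB-cong xs pointwise) (countB-∧-≟ enum (p a) a)
  where
  pointwise : ∀ x → p x ≡ p a ∧ ⌊ eq? x a ⌋
  pointwise x with eq? x a
  ... | yes refl = sym (∧-identityʳ (p x))
  ... | no x≢a with p x in px
  ...   | true  = ⊥-elim (x≢a (only-a x (Equivalence.from T-≡ px)))
  ...   | false = sym (∧-zeroʳ (p a))

-- Double counting the pairs (a , f a) with p a, once from each side.
countB-bijection : ∀ {A B : Set} {eqA? : DecidableEquality A} {eqB? : DecidableEquality B} {xs ys} →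
  Enumerates eqA? xs → Enumerates eqB? ys → (p : A → Bool) (f : A → B) (g : B → A) →
  (∀ a → T (p a) → g (f a) ≡ a) → (∀ b → T (p (g b)) → f (g b) ≡ b) →
  countB p xs ≡ countB (p ∘ g) ys
countB-bijection {eqA? = eqA?} {eqB?} {xs} {ys} enumA enumB p f g gf fg = begin
  countB p xs
    ≡⟨ countB≡sum p xs ⟩
  sum (map (indicator ∘ p) xs)
    ≡⟨ cong sum (map-cong (λ a → countB-∧-≟ enumB (p a) (f a)) xs) ⟨
  sum (map (λ a → countB (λ b → p a ∧ ⌊ eqB? b (f a) ⌋) ys) xs)
    ≡⟨ cong sum (map-cong (λ a → countB≡sum _ ys) xs) ⟩
  sum (map (λ a → sum (map (λ b → indicator (p a ∧ ⌊ eqB? b (f a) ⌋)) ys)) xs)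
    ≡⟨ sum-map-swap _ xs ys ⟩
  sum (map (λ b → sum (map (λ a → indicator (p a ∧ ⌊ eqB? b (f a) ⌋)) xs)) ys)
    ≡⟨ cong sum (map-cong (λ b → cong sum (map-cong (λ a → cong indicator (graph-symmetric a b)) xs)) ys) ⟩
  sum (map (λ b → sum (map (λ a → indicator (p (g b) ∧ ⌊ eqA? a (g b) ⌋)) xs)) ys)
    ≡⟨ cong sum (map-cong (λ b → countB≡sum _ xs) ys) ⟨
  sum (map (λ b → countB (λ a → p (g b) ∧ ⌊ eqA? a (g b) ⌋) xs) ys)
    ≡⟨ cong sum (map-cong (λ b → countB-∧-≟ enumA (p (g b)) (g b)) ys) ⟩
  sum (map (indicator ∘ p ∘ g) ys)
    ≡⟨ countB≡sum (p ∘ g) ys ⟨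
  countB (p ∘ g) ys
    ∎
  where
  graph-symmetric : ∀ a b → (p a ∧ ⌊ eqB? b (f a) ⌋) ≡ (p (g b) ∧ ⌊ eqA? a (g b) ⌋)
  graph-symmetric a b with eqB? b (f a) | eqA? a (g b)
  ... | yes refl | yes a≡gfa = cong (λ z → p z ∧ true) a≡gfa
  ... | no _     | no _      = trans (∧-zeroʳ (p a)) (sym (∧-zeroʳ (p (g b))))
  ... | yes refl | no a≢gfa with p a in pa
  ...   | true  = ⊥-elim (a≢gfa (sym (gf a (Equivalence.from T-≡ pa))))
  ...   | false = sym (∧-zeroʳ _)
  graph-symmetric a b | no b≢fgb | yes refl with p (g b) in pgb
  ...   | true  = ⊥-elim (b≢fgb (sym (fg b (Equivalence.from T-≡ pgb))))
  ...   | false = refl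

concatMap-map-enumerates : ∀ {A B C : Set} {eqA? : DecidableEquality A} {eqB? : DecidableEquality B}
  {eqC? : DecidableEquality C} (h : A → B → C) → (∀ {a b a′ b′} → h a b ≡ h a′ b′ → a ≡ a′ × b ≡ b′) →
  ∀ {xs ys} → Enumerates eqA? xs → Enumerates eqB? ys →
  ∀ a b → countB (λ c → ⌊ eqC? c (h a b) ⌋) (concatMap (λ x → map (h x) ys) xs) ≡ 1
concatMap-map-enumerates {eqA? = eqA?} {eqB?} {eqC?} h h-injective {xs} {ys} enumA enumB a b = begin
  countB P (concatMap (λ x → map (h x) ys) xs)   ≡⟨ countB-concatMap-map P h xs ys ⟩
  sum (map (λ x → countB (P ∘ h x) ys) xs)       ≡⟨ cong sum (map-cong count-row xs) ⟩
  sum (map (indicator ∘ (λ x → ⌊ eqA? x a ⌋)) xs) ≡⟨ countB≡sum _ xs ⟨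
  countB (λ x → ⌊ eqA? x a ⌋) xs                 ≡⟨ occurs-once enumA a ⟩
  1                                              ∎
  where
  P : _ → Bool
  P c = ⌊ eqC? c (h a b) ⌋
  graph : ∀ x y → P (h x y) ≡ ⌊ eqA? x a ⌋ ∧ ⌊ eqB? y b ⌋
  graph x y with eqA? x a | eqB? y b
  ... | yes refl | yes refl = ⌊⌋-true (eqC? (h x y) (h x y)) refl
  ... | yes refl | no y≢b   = ⌊⌋-false (eqC? (h x y) (h x b)) (y≢b ∘ proj₂ ∘ h-injective)
  ... | no x≢a   | _        = ⌊⌋-false (eqC? (h x y) (h a b)) (x≢a ∘ proj₁ ∘ h-injective)
  count-row : ∀ x → countB (P ∘ h x) ys ≡ indicator ⌊ eqA? x a ⌋
  count-row x = trans (countB-cong ys (graph x)) (countB-∧-≟ enumB _ b)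

allFin-suc : ∀ n → allFin (suc n) ≡ zero ∷ map suc (allFin n)
allFin-suc n = cong (zero ∷_) (sym (map-tabulate id suc))

allFin-enumerates : ∀ {n} → Enumerates _≟_ (allFin n)
allFin-enumerates {n} = occurring-once (count n)
  where
  count : ∀ n (i : Fin n) → countB (λ x → ⌊ x ≟ i ⌋) (allFin n) ≡ 1
  count (suc n) i = trans (cong (countB (λ x → ⌊ x ≟ i ⌋)) (allFin-suc n)) (count-suc i)
    where
    count-suc : ∀ i → countB (λ x → ⌊ x ≟ i ⌋) (zero ∷ map suc (allFin n)) ≡ 1
    count-suc zero    = cong suc (trans (countB-map _ suc (allFin n)) (countB-false _ (allFin n) (λ _ → refl)))
    count-suc (suc i) = begin
      countB (λ x → ⌊ x ≟ suc i ⌋) (map suc (allFin n)) ≡⟨ countB-map _ suc (allFin n) ⟩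
      countB (λ x → ⌊ suc x ≟ suc i ⌋) (allFin n)       ≡⟨ countB-cong (allFin n) (λ x → ⌊⌋-map′ (cong suc) suc-injective (x ≟ i)) ⟩
      countB (λ x → ⌊ x ≟ i ⌋) (allFin n)               ≡⟨ count n i ⟩
      1                                                 ∎

sum-map-allFin-suc : ∀ {n} (h : Fin (suc n) → ℕ) →
  sum (map h (allFin (suc n))) ≡ h zero + sum (map (h ∘ suc) (allFin n))
sum-map-allFin-suc {n} h =
  trans (cong (sum ∘ map h) (allFin-suc n)) (cong (h zero +_) (cong sum (sym (map-∘ (allFin n)))))

sum-map-allFin-last : ∀ {n} (h : Fin (suc n) → ℕ) →
  sum (map h (allFin (suc n))) ≡ sum (map (h ∘ inject₁) (allFin n)) + h (fromℕ n)
sum-map-allFin-last {zero}  h = +-comm (h zero) 0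
sum-map-allFin-last {suc n} h = begin
  sum (map h (allFin (suc (suc n))))
    ≡⟨ sum-map-allFin-suc h ⟩
  h zero + sum (map (h ∘ suc) (allFin (suc n)))
    ≡⟨ cong (h zero +_) (sum-map-allFin-last (h ∘ suc)) ⟩
  h zero + (sum (map (h ∘ suc ∘ inject₁) (allFin n)) + h (fromℕ (suc n)))
    ≡⟨ +-assoc (h zero) _ _ ⟨
  h zero + sum (map (h ∘ suc ∘ inject₁) (allFin n)) + h (fromℕ (suc n))
    ≡⟨ cong (_+ h (fromℕ (suc n))) (sum-map-allFin-suc (h ∘ inject₁)) ⟨
  sum (map (h ∘ inject₁) (allFin (suc n))) + h (fromℕ (suc n))
    ∎

sum-map-allFin-const : ∀ n c → sum (map (λ (_ : Fin n) → c) (allFin n)) ≡ n * c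
sum-map-allFin-const zero    c = refl
sum-map-allFin-const (suc n) c = trans (sum-map-allFin-suc {n} (λ _ → c)) (cong (c +_) (sum-map-allFin-const n c))

_≟ᵛ_ : ∀ {n k} → DecidableEquality (Vec (Fin n) k)
_≟ᵛ_ = Vec.≡-dec _≟_

allVecs-enumerates : ∀ {n} k → Enumerates _≟ᵛ_ (allVecs k n)
allVecs-enumerates {n} k = occurring-once (count k)
  where
  count : ∀ k (v : Vec (Fin n) k) → countB (λ w → ⌊ w ≟ᵛ v ⌋) (allVecs k n) ≡ 1
  count zero    []      = refl
  count (suc k) (x ∷ v) =
    concatMap-map-enumerates {eqC? = _≟ᵛ_} _∷_ Vec.∷-injective allFin-enumerates (allVecs-enumerates k) x v

-- Cycles of a permutation

IsPermutation : ∀ {n} → Endo n → Set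
IsPermutation σ = Injective _≡_ _≡_ (lookup σ)

Reaches : ∀ {n} → Endo n → Fin n → Fin n → Set
Reaches σ i j = ∃ λ k → iter σ k i ≡ j

IsCycleMin : ∀ {n} → Endo n → Fin n → Set
IsCycleMin σ i = ∀ k → toℕ i ≤ toℕ (iter σ k i)

DistinctCycles : ℕ → ∀ {n} → Endo n → Set
DistinctCycles r σ = ∀ i j → toℕ i < toℕ j → toℕ j < r → ¬ Reaches σ i j

module _ {n} (σ : Endo n) where

  injectivity : Fin n → Fin n → Bool
  injectivity i j = not (lookup σ i == lookup σ j) ∨ (i == j)

  distinctness : ℕ → Fin n → Fin n → Bool
  distinctness r i j = not ((toℕ i <ᵇ toℕ j) ∧ (toℕ j <ᵇ r)) ∨ not (sameCycle σ i j)

  iter-suc : ∀ k i → iter σ (suc k) i ≡ iter σ k (lookup σ i)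
  iter-suc zero    i = refl
  iter-suc (suc k) i = cong (lookup σ) (iter-suc k i)

  iter-+ : ∀ a b i → iter σ (a + b) i ≡ iter σ a (iter σ b i)
  iter-+ zero    b i = refl
  iter-+ (suc a) b i = cong (lookup σ) (iter-+ a b i)

  Reaches-lookup : ∀ {i j} → Reaches σ (lookup σ i) j → Reaches σ i j
  Reaches-lookup {i} (k , e) = suc k , trans (iter-suc k i) e

  iter-injective : IsPermutation σ → ∀ k → Injective _≡_ _≡_ (iter σ k)
  iter-injective perm zero    e = e
  iter-injective perm (suc k) e = iter-injective perm k (perm e)

  -- Pigeonhole on σ⁰ i, …, σⁿ i.
  period : IsPermutation σ → ∀ i → ∃ λ p → 1 ≤ p × p ≤ n × iter σ p i ≡ i
  period perm i with a , b , a<b , σᵃi≡σᵇi ← pigeonhole (n<1+n n) (λ (k : Fin (suc n)) → iter σ (toℕ k) i) =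
    toℕ b ∸ toℕ a , m<n⇒0<n∸m a<b , ≤-trans (m∸n≤m (toℕ b) (toℕ a)) (s≤s⁻¹ (toℕ<n b)) ,
    sym (iter-injective perm (toℕ a) (begin
      iter σ (toℕ a) i                           ≡⟨ σᵃi≡σᵇi ⟩
      iter σ (toℕ b) i                           ≡⟨ cong (λ k → iter σ k i) (m+[n∸m]≡n (<⇒≤ a<b)) ⟨
      iter σ (toℕ a + (toℕ b ∸ toℕ a)) i         ≡⟨ iter-+ (toℕ a) _ i ⟩
      iter σ (toℕ a) (iter σ (toℕ b ∸ toℕ a) i)  ∎))

  iter-reduce : IsPermutation σ → ∀ k i → ∃ λ k′ → k′ < n × iter σ k i ≡ iter σ k′ i
  iter-reduce perm k i with p , 1≤p , p≤n , σᵖi≡i ← period perm i =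
    let k′ , k′<p , e = reduce k in k′ , <-≤-trans k′<p p≤n , e
    where
    reduce : ∀ k → ∃ λ k′ → k′ < p × iter σ k i ≡ iter σ k′ i
    reduce zero = 0 , 1≤p , refl
    reduce (suc k) with k′ , k′<p , e ← reduce k | suc k′ <? p
    ... | yes k′+1<p = suc k′ , k′+1<p , cong (lookup σ) e
    ... | no  k′+1≮p = 0 , 1≤p , (begin
      lookup σ (iter σ k i)  ≡⟨ cong (lookup σ) e ⟩
      iter σ (suc k′) i      ≡⟨ cong (λ m → iter σ m i) (≤-antisym k′<p (≮⇒≥ k′+1≮p)) ⟩
      iter σ p i             ≡⟨ σᵖi≡i ⟩
      i                      ∎)

  isPerm⇒injective : T (isPerm σ) → IsPermutation σ
  isPerm⇒injective h {x} {y} σx≡σy =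
    toWitness (T-implication⁻ (lookup σ x == lookup σ y) (x == y) (all-allFin²⁻ injectivity h x y) (fromWitness σx≡σy))

  injective⇒isPerm : IsPermutation σ → T (isPerm σ)
  injective⇒isPerm perm =
    all-allFin²⁺ injectivity λ x y → T-implication⁺ (lookup σ x == lookup σ y) (x == y) λ e → fromWitness (perm (toWitness e))

  sameCycle⇒Reaches : ∀ {i j} → T (sameCycle σ i j) → Reaches σ i j
  sameCycle⇒Reaches {i} {j} h with k , e ← any-upTo⁻ {n} (λ k → iter σ k i == j) h = k , toWitness e

  Reaches⇒sameCycle : IsPermutation σ → ∀ {i j} → Reaches σ i j → T (sameCycle σ i j)
  Reaches⇒sameCycle perm {i} {j} (k , σᵏi≡j) with k′ , k′<n , e ← iter-reduce perm k i =
    any-upTo⁺ {n} (λ k → iter σ k i == j) k′<n (fromWitness (trans (sym e) σᵏi≡j))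

  cycleMin⇒IsCycleMin : IsPermutation σ → ∀ {i} → T (cycleMin σ i) → IsCycleMin σ i
  cycleMin⇒IsCycleMin perm {i} h k with k′ , k′<n , e ← iter-reduce perm k i =
    subst (λ x → toℕ i ≤ toℕ x) (sym e) (≤ᵇ⇒≤ _ _ (all-upTo⁻ {n} (λ k → toℕ i ≤ᵇ toℕ (iter σ k i)) h k′<n))

  IsCycleMin⇒cycleMin : ∀ {i} → IsCycleMin σ i → T (cycleMin σ i)
  IsCycleMin⇒cycleMin {i} min = all-upTo⁺ {n} (λ k → toℕ i ≤ᵇ toℕ (iter σ k i)) λ {k} _ → ≤⇒≤ᵇ (min k)

  firstDistinct⇒DistinctCycles : IsPermutation σ → ∀ r → T (firstDistinct r σ) → DistinctCycles r σ
  firstDistinct⇒DistinctCycles perm r h i j i<j j<r reach =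
    T-not⁻ (sameCycle σ i j) (T-implication⁻ ((toℕ i <ᵇ toℕ j) ∧ (toℕ j <ᵇ r)) _ (all-allFin²⁻ (distinctness r) h i j) (Equivalence.from T-∧ (<⇒<ᵇ i<j , <⇒<ᵇ j<r)))
      (Reaches⇒sameCycle perm reach)

  DistinctCycles⇒firstDistinct : ∀ r → DistinctCycles r σ → T (firstDistinct r σ)
  DistinctCycles⇒firstDistinct r distinct =
    all-allFin²⁺ (distinctness r) λ i j → T-implication⁺ ((toℕ i <ᵇ toℕ j) ∧ (toℕ j <ᵇ r)) _ λ h → T-not⁺ (sameCycle σ i j) λ same →
      let i<j , j<r = Equivalence.to T-∧ h in
      distinct i j (<ᵇ⇒< _ _ i<j) (<ᵇ⇒< _ _ j<r) (sameCycle⇒Reaches same)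

lookup-extensionality : ∀ {A : Set} {n} (u v : Vec A n) → (∀ i → lookup u i ≡ lookup v i) → u ≡ v
lookup-extensionality u v e =
  trans (sym (Vec.tabulate∘lookup u)) (trans (Vec.tabulate-cong e) (Vec.tabulate∘lookup v))

identity : ∀ n → Endo n
identity n = Vec.tabulate id

iter-identity : ∀ {n} k (i : Fin n) → iter (identity n) k i ≡ i
iter-identity zero    i = refl
iter-identity (suc k) i = trans (cong (lookup (identity _)) (iter-identity k i)) (Vec.lookup∘tabulate id i)

identity-injective : ∀ {n} → IsPermutation (identity n)
identity-injective {n} {x} {y} e = trans (sym (Vec.lookup∘tabulate id x)) (trans e (Vec.lookup∘tabulate id y))

numCycles-identity : ∀ n → numCycles (identity n) ≡ n
numCycles-identity n = trans (countB-true _ (allFin n) each-min) (length-tabulate id)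
  where
  each-min : ∀ i → cycleMin (identity n) i ≡ true
  each-min i = T⇒≡true (IsCycleMin⇒cycleMin (identity n) λ k → ≤-reflexive (cong toℕ (sym (iter-identity k i))))

identity-DistinctCycles : ∀ r {n} → DistinctCycles r (identity n)
identity-DistinctCycles r i j i<j _ (k , e) = <-irrefl (cong toℕ (trans (sym (iter-identity k i)) e)) i<j

-- An element smaller than its image, or larger than it, would share a cycle with it.
DistinctCycles⇒identity : ∀ {n} (σ : Endo n) → IsPermutation σ → DistinctCycles n σ → σ ≡ identity n
DistinctCycles⇒identity {n} σ perm distinct =
  lookup-extensionality σ (identity n) λ i → trans (fixed i) (sym (Vec.lookup∘tabulate id i))
  where
  fixed : ∀ i → lookup σ i ≡ i
  fixed i with period σ perm i | <-cmp (toℕ i) (toℕ (lookup σ i))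
  ... | _ , _ , _ , _ | tri≈ _ i≡σi _ = sym (toℕ-injective i≡σi)
  ... | _ , _ , _ , _ | tri< i<σi _ _ = ⊥-elim (distinct i (lookup σ i) i<σi (toℕ<n _) (1 , refl))
  ... | suc p , _ , _ , σᵖ⁺¹i≡i | tri> _ _ σi<i =
    ⊥-elim (distinct (lookup σ i) i σi<i (toℕ<n i) (p , trans (sym (iter-suc σ p i)) σᵖ⁺¹i≡i))

-- Inserting the largest element

-- Fin (suc n) viewed as Maybe (Fin n), with nothing standing for the largest element n.
embed : ∀ {n} → Maybe (Fin n) → Fin (suc n)
embed nothing  = fromℕ _
embed (just x) = inject₁ x

restrict : ∀ {n} → Fin (suc n) → Maybe (Fin n)
restrict {zero}  zero    = nothing
restrict {suc n} zero    = just zero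
restrict {suc n} (suc i) = Maybe.map suc (restrict i)

just≢nothing : ∀ {A : Set} {a : A} → just a ≢ nothing
just≢nothing ()

restrict-embed : ∀ {n} (a : Maybe (Fin n)) → restrict (embed a) ≡ a
restrict-embed {zero}  nothing        = refl
restrict-embed {suc n} nothing        = cong (Maybe.map suc) (restrict-embed {n} nothing)
restrict-embed {suc n} (just zero)    = refl
restrict-embed {suc n} (just (suc x)) = cong (Maybe.map suc) (restrict-embed (just x))

embed-restrict : ∀ {n} (i : Fin (suc n)) → embed (restrict i) ≡ i
embed-restrict {zero}  zero    = refl
embed-restrict {suc n} zero    = refl
embed-restrict {suc n} (suc i) with restrict i | embed-restrict i
... | nothing | e = cong suc e
... | just _  | e = cong suc e

embed-injective : ∀ {n} → Injective _≡_ _≡_ (embed {n})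
embed-injective {x = a} {b} e = trans (sym (restrict-embed a)) (trans (cong restrict e) (restrict-embed b))

restrict-injective : ∀ {n} → Injective _≡_ _≡_ (restrict {n})
restrict-injective {x = i} {j} e = trans (sym (embed-restrict i)) (trans (cong embed e) (embed-restrict j))

inject₁-below : ∀ {n} (i : Fin (suc n)) → toℕ i < n → ∃ λ x → inject₁ x ≡ i
inject₁-below i i<n = lower₁ i n≢i , inject₁-lower₁ i n≢i
  where n≢i = λ n≡i → <-irrefl (sym n≡i) i<n

-- insertAfter (just j) t splices the new point into the cycle of t right after j;
-- insertAfter nothing t adds it as a fixed point.
insertAfter : ∀ {n} → Maybe (Fin n) → (Fin n → Fin n) → Maybe (Fin n) → Maybe (Fin n)
insertAfter nothing  t nothing  = nothing
insertAfter nothing  t (just x) = just (t x)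
insertAfter (just j) t nothing  = just (t j)
insertAfter (just j) t (just x) with x ≟ j
... | yes _ = nothing
... | no  _ = just (t x)

insertAfter-self : ∀ {n} (mj : Maybe (Fin n)) t → insertAfter mj t mj ≡ nothing
insertAfter-self nothing  t = refl
insertAfter-self (just j) t with j ≟ j
... | yes _   = refl
... | no  j≢j = ⊥-elim (j≢j refl)

insertAfter-≢ : ∀ {n} (j x : Fin n) t → x ≢ j → insertAfter (just j) t (just x) ≡ just (t x)
insertAfter-≢ j x t x≢j with x ≟ j
... | yes x≡j = ⊥-elim (x≢j x≡j)
... | no  _   = refl

insertAfter-cong : ∀ {n} mj {t t′ : Fin n → Fin n} → (∀ x → t x ≡ t′ x) → ∀ a → insertAfter mj t a ≡ insertAfter mj t′ a
insertAfter-cong nothing  t≗t′ nothing  = refl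
insertAfter-cong nothing  t≗t′ (just x) = cong just (t≗t′ x)
insertAfter-cong (just j) t≗t′ nothing  = cong just (t≗t′ j)
insertAfter-cong (just j) t≗t′ (just x) with x ≟ j
... | yes _ = refl
... | no  _ = cong just (t≗t′ x)

insertMax : ∀ {n} → Fin (suc n) → Endo n → Endo (suc n)
insertMax j τ = Vec.tabulate (embed ∘ insertAfter (restrict j) (lookup τ) ∘ restrict)

lookup-insertMax : ∀ {n} j (τ : Endo n) a →
  lookup (insertMax j τ) (embed a) ≡ embed (insertAfter (restrict j) (lookup τ) a)
lookup-insertMax j τ a =
  trans (Vec.lookup∘tabulate (embed ∘ insertAfter (restrict j) (lookup τ) ∘ restrict) (embed a)) (cong (embed ∘ insertAfter (restrict j) (lookup τ)) (restrict-embed a))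

module _ {n} (τ : Endo n) where

  iterAfter : Maybe (Fin n) → ℕ → Maybe (Fin n) → Maybe (Fin n)
  iterAfter mj zero    a = a
  iterAfter mj (suc k) a = insertAfter mj (lookup τ) (iterAfter mj k a)

  ReachesAfter : Maybe (Fin n) → Maybe (Fin n) → Maybe (Fin n) → Set
  ReachesAfter mj a b = ∃ λ k → iterAfter mj k a ≡ b

  iterAfter-+ : ∀ mj k l a → iterAfter mj (k + l) a ≡ iterAfter mj k (iterAfter mj l a)
  iterAfter-+ mj zero    l a = refl
  iterAfter-+ mj (suc k) l a = cong (insertAfter mj (lookup τ)) (iterAfter-+ mj k l a)

  iterAfter-suc : ∀ mj k a → iterAfter mj (suc k) a ≡ iterAfter mj k (insertAfter mj (lookup τ) a)
  iterAfter-suc mj zero    a = refl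
  iterAfter-suc mj (suc k) a = cong (insertAfter mj (lookup τ)) (iterAfter-suc mj k a)

  iterAfter-fixed : ∀ k → iterAfter nothing k nothing ≡ nothing
  iterAfter-fixed zero    = refl
  iterAfter-fixed (suc k) = cong (insertAfter nothing (lookup τ)) (iterAfter-fixed k)

  ReachesAfter-trans : ∀ mj {a b c} → ReachesAfter mj a b → ReachesAfter mj b c → ReachesAfter mj a c
  ReachesAfter-trans mj {a} (k , e) (l , e′) =
    l + k , trans (iterAfter-+ mj l k a) (trans (cong (iterAfter mj l) e) e′)

  ReachesAfter-step : ∀ mj x → ReachesAfter mj (just x) (just (lookup τ x))
  ReachesAfter-step nothing  x = 1 , refl
  ReachesAfter-step (just j) x with x ≟ j
  ... | yes refl = 2 , cong (insertAfter (just x) (lookup τ)) (insertAfter-self (just x) (lookup τ))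
  ... | no  x≢j  = 1 , insertAfter-≢ j x (lookup τ) x≢j

  Reaches⇒ReachesAfter : ∀ mj {x y} → Reaches τ x y → ReachesAfter mj (just x) (just y)
  Reaches⇒ReachesAfter mj     (zero  , refl) = 0 , refl
  Reaches⇒ReachesAfter mj {x} (suc k , refl) =
    ReachesAfter-trans mj (Reaches⇒ReachesAfter mj (k , refl)) (ReachesAfter-step mj (iter τ k x))

  -- Where a point leads in τ; the new point, inserted after j, continues as τ j.
  ReachesVia : Maybe (Fin n) → Maybe (Fin n) → Fin n → Set
  ReachesVia mj       (just x) y = Reaches τ x y
  ReachesVia nothing  nothing  y = ⊥
  ReachesVia (just j) nothing  y = Reaches τ (lookup τ j) y

  ReachesVia-insertAfter : ∀ mj a {y} → ReachesVia mj (insertAfter mj (lookup τ) a) y → ReachesVia mj a y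
  ReachesVia-insertAfter nothing  nothing  r = r
  ReachesVia-insertAfter (just j) nothing  r = r
  ReachesVia-insertAfter nothing  (just x) r = Reaches-lookup τ r
  ReachesVia-insertAfter (just j) (just x) r with x ≟ j
  ... | yes refl = Reaches-lookup τ r
  ... | no  _    = Reaches-lookup τ r

  iterAfter⇒ReachesVia : ∀ mj k a {y} → iterAfter mj k a ≡ just y → ReachesVia mj a y
  iterAfter⇒ReachesVia mj zero    (just x) refl = 0 , refl
  iterAfter⇒ReachesVia mj zero    nothing  ()
  iterAfter⇒ReachesVia mj (suc k) a        e    =
    ReachesVia-insertAfter mj a (iterAfter⇒ReachesVia mj k _ (trans (sym (iterAfter-suc mj k a)) e))

  ReachesAfter⇒Reaches : ∀ mj {x y} → ReachesAfter mj (just x) (just y) → Reaches τ x y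
  ReachesAfter⇒Reaches mj (k , e) = iterAfter⇒ReachesVia mj k _ e

  insertAfter-injective : IsPermutation τ → ∀ mj → Injective _≡_ _≡_ (insertAfter mj (lookup τ))
  insertAfter-injective perm nothing  {nothing} {nothing} e = refl
  insertAfter-injective perm nothing  {just x}  {just y}  e = cong just (perm (just-injective e))
  insertAfter-injective perm (just j) {nothing} {nothing} e = refl
  insertAfter-injective perm (just j) {nothing} {just y}  e with y ≟ j
  ... | no  y≢j = ⊥-elim (y≢j (sym (perm (just-injective e))))
  insertAfter-injective perm (just j) {just x}  {nothing} e with x ≟ j
  ... | no  x≢j = ⊥-elim (x≢j (perm (just-injective e)))
  insertAfter-injective perm (just j) {just x}  {just y}  e with x ≟ j | y ≟ j
  ... | yes refl | yes refl = refl
  ... | no  _    | no  _    = cong just (perm (just-injective e))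

  insertAfter-injective⁻ : ∀ mj → Injective _≡_ _≡_ (insertAfter mj (lookup τ)) → IsPermutation τ
  insertAfter-injective⁻ nothing  inj e = just-injective (inj (cong just e))
  insertAfter-injective⁻ (just j) inj {x} {y} e with x ≟ j | y ≟ j
  ... | yes x≡j | yes y≡j = trans x≡j (sym y≡j)
  ... | yes refl | no y≢j = ⊥-elim (just≢nothing (inj (trans (insertAfter-≢ j y _ y≢j) (cong just (sym e)))))
  ... | no x≢j | yes refl = ⊥-elim (just≢nothing (inj (trans (insertAfter-≢ j x _ x≢j) (cong just e))))
  ... | no x≢j | no y≢j =
    just-injective (inj (trans (insertAfter-≢ j x _ x≢j) (trans (cong just e) (sym (insertAfter-≢ j y _ y≢j)))))

module _ {n} (j : Fin (suc n)) (τ : Endo n) where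

  private
    σ : Endo (suc n)
    σ = insertMax j τ

  iter-insertMax : ∀ k a → iter σ k (embed a) ≡ embed (iterAfter τ (restrict j) k a)
  iter-insertMax zero    a = refl
  iter-insertMax (suc k) a = trans (cong (lookup σ) (iter-insertMax k a)) (lookup-insertMax j τ _)

  Reaches-insertMax⁻ : ∀ {a b} → Reaches σ (embed a) (embed b) → ReachesAfter τ (restrict j) a b
  Reaches-insertMax⁻ {a} (k , e) = k , embed-injective (trans (sym (iter-insertMax k a)) e)

  Reaches-insertMax⁺ : ∀ {a b} → ReachesAfter τ (restrict j) a b → Reaches σ (embed a) (embed b)
  Reaches-insertMax⁺ {a} (k , e) = k , trans (iter-insertMax k a) (cong embed e)

  insertMax-injective : IsPermutation τ → IsPermutation σ
  insertMax-injective perm {x} {y} e =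
    restrict-injective (insertAfter-injective τ perm (restrict j) (embed-injective (begin
      embed (insertAfter (restrict j) (lookup τ) (restrict x)) ≡⟨ lookup-insertMax j τ (restrict x) ⟨
      lookup σ (embed (restrict x))                            ≡⟨ cong (lookup σ) (embed-restrict x) ⟩
      lookup σ x                                               ≡⟨ e ⟩
      lookup σ y                                               ≡⟨ cong (lookup σ) (embed-restrict y) ⟨
      lookup σ (embed (restrict y))                            ≡⟨ lookup-insertMax j τ (restrict y) ⟩
      embed (insertAfter (restrict j) (lookup τ) (restrict y)) ∎)))

  insertMax-injective⁻ : IsPermutation σ → IsPermutation τ
  insertMax-injective⁻ perm = insertAfter-injective⁻ τ (restrict j) λ {a} {b} e → embed-injective (perm (begin
    lookup σ (embed a)                            ≡⟨ lookup-insertMax j τ a ⟩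
    embed (insertAfter (restrict j) (lookup τ) a) ≡⟨ cong embed e ⟩
    embed (insertAfter (restrict j) (lookup τ) b) ≡⟨ lookup-insertMax j τ b ⟨
    lookup σ (embed b)                            ∎))

  isPerm-insertMax : isPerm σ ≡ isPerm τ
  isPerm-insertMax = T-extensional
    (injective⇒isPerm τ ∘ insertMax-injective⁻ ∘ isPerm⇒injective σ)
    (injective⇒isPerm σ ∘ insertMax-injective ∘ isPerm⇒injective τ)

  IsCycleMin-insertMax⁺ : ∀ x → IsCycleMin τ x → IsCycleMin σ (inject₁ x)
  IsCycleMin-insertMax⁺ x min k rewrite iter-insertMax k (just x) with iterAfter τ (restrict j) k (just x) in e
  ... | nothing = subst₂ _≤_ (sym (toℕ-inject₁ x)) (sym (toℕ-fromℕ n)) (<⇒≤ (toℕ<n x))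
  ... | just y  with k′ , τᵏ′x≡y ← ReachesAfter⇒Reaches τ (restrict j) (k , e) =
    subst₂ _≤_ (sym (toℕ-inject₁ x)) (sym (toℕ-inject₁ y)) (subst (λ z → toℕ x ≤ toℕ z) τᵏ′x≡y (min k′))

  IsCycleMin-insertMax⁻ : ∀ x → IsCycleMin σ (inject₁ x) → IsCycleMin τ x
  IsCycleMin-insertMax⁻ x min k with k′ , e ← Reaches⇒ReachesAfter τ (restrict j) {x} (k , refl) =
    subst₂ _≤_ (toℕ-inject₁ x) (trans (cong toℕ (trans (iter-insertMax k′ (just x)) (cong embed e))) (toℕ-inject₁ _))
      (min k′)

  cycleMin-insertMax-old : IsPermutation τ → ∀ x → cycleMin σ (inject₁ x) ≡ cycleMin τ x
  cycleMin-insertMax-old perm x = T-extensional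
    (IsCycleMin⇒cycleMin τ ∘ IsCycleMin-insertMax⁻ x ∘ cycleMin⇒IsCycleMin σ (insertMax-injective perm))
    (IsCycleMin⇒cycleMin σ ∘ IsCycleMin-insertMax⁺ x ∘ cycleMin⇒IsCycleMin τ perm)

  -- Unless it is a fixed point, the new point n has a smaller image.
  cycleMin-insertMax-new : IsPermutation τ → cycleMin σ (fromℕ n) ≡ is-nothing (restrict j)
  cycleMin-insertMax-new perm = by-restriction (restrict j) refl
    where
    by-restriction : ∀ mj → restrict j ≡ mj → cycleMin σ (fromℕ n) ≡ is-nothing mj
    by-restriction nothing j↦ = T⇒≡true (IsCycleMin⇒cycleMin σ λ k → ≤-reflexive (cong toℕ (sym (fixed k))))
      where
      fixed : ∀ k → iter σ k (fromℕ n) ≡ fromℕ n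
      fixed k = trans (iter-insertMax k nothing)
                      (cong embed (trans (cong (λ mj → iterAfter τ mj k nothing) j↦) (iterAfter-fixed τ k)))
    by-restriction (just i) j↦ = ¬T⇒≡false λ h →
      <⇒≱ (toℕ<n (lookup τ i))
          (subst₂ _≤_ (toℕ-fromℕ n) (trans (cong toℕ step) (toℕ-inject₁ _))
                  (cycleMin⇒IsCycleMin σ (insertMax-injective perm) h 1))
      where
      step : iter σ 1 (fromℕ n) ≡ inject₁ (lookup τ i)
      step = trans (iter-insertMax 1 nothing) (cong (λ mj → embed (iterAfter τ mj 1 nothing)) j↦)

  numCycles-insertMax : IsPermutation τ → numCycles σ ≡ indicator (is-nothing (restrict j)) + numCycles τ
  numCycles-insertMax perm = begin
    numCycles σ
      ≡⟨ countB≡sum (cycleMin σ) (allFin (suc n)) ⟩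
    sum (map (indicator ∘ cycleMin σ) (allFin (suc n)))
      ≡⟨ sum-map-allFin-last (indicator ∘ cycleMin σ) ⟩
    sum (map (indicator ∘ cycleMin σ ∘ inject₁) (allFin n)) + indicator (cycleMin σ (fromℕ n))
      ≡⟨ cong₂ _+_ (cong sum (map-cong (cong indicator ∘ cycleMin-insertMax-old perm) (allFin n)))
                   (cong indicator (cycleMin-insertMax-new perm)) ⟩
    sum (map (indicator ∘ cycleMin τ) (allFin n)) + indicator (is-nothing (restrict j))
      ≡⟨ cong (_+ _) (countB≡sum (cycleMin τ) (allFin n)) ⟨
    numCycles τ + indicator (is-nothing (restrict j))
      ≡⟨ +-comm (numCycles τ) _ ⟩
    indicator (is-nothing (restrict j)) + numCycles τ
      ∎

  DistinctCycles-insertMax⁻ : ∀ r → DistinctCycles r σ → DistinctCycles r τ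
  DistinctCycles-insertMax⁻ r distinct x y x<y y<r reach =
    distinct (inject₁ x) (inject₁ y)
      (subst₂ _<_ (sym (toℕ-inject₁ x)) (sym (toℕ-inject₁ y)) x<y) (subst (_< r) (sym (toℕ-inject₁ y)) y<r)
      (Reaches-insertMax⁺ (Reaches⇒ReachesAfter τ (restrict j) reach))

  -- Only old points lie below r ≤ n.
  DistinctCycles-insertMax⁺ : ∀ r → r ≤ n → DistinctCycles r τ → DistinctCycles r σ
  DistinctCycles-insertMax⁺ r r≤n distinct i i′ i<i′ i′<r reach
    with x , refl ← inject₁-below i (<-trans i<i′ (<-≤-trans i′<r r≤n))
       | y , refl ← inject₁-below i′ (<-≤-trans i′<r r≤n) =
    distinct x y (subst₂ _<_ (toℕ-inject₁ x) (toℕ-inject₁ y) i<i′) (subst (_< r) (toℕ-inject₁ y) i′<r)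
      (ReachesAfter⇒Reaches τ (restrict j) (Reaches-insertMax⁻ reach))

  firstDistinct-insertMax : ∀ r → r ≤ n → IsPermutation τ → firstDistinct r σ ≡ firstDistinct r τ
  firstDistinct-insertMax r r≤n perm = T-extensional
    (DistinctCycles⇒firstDistinct τ r ∘ DistinctCycles-insertMax⁻ r ∘ firstDistinct⇒DistinctCycles σ (insertMax-injective perm) r)
    (DistinctCycles⇒firstDistinct σ r ∘ DistinctCycles-insertMax⁺ r r≤n ∘ firstDistinct⇒DistinctCycles τ perm r)

injective⇒hitsMax : ∀ {n} (σ : Endo (suc n)) → IsPermutation σ → ∃ λ x → lookup σ x ≡ fromℕ n
injective⇒hitsMax {n} σ perm with any? (λ x → lookup σ x ≟ fromℕ n)
... | yes hit  = hit
... | no  miss = ⊥-elim (<-irrefl refl (injective⇒≤ squeeze-injective))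
  where
  squeeze : Fin (suc n) → Fin n
  squeeze x = punchOut {i = fromℕ n} {j = lookup σ x} (λ e → miss (x , sym e))
  squeeze-injective : Injective _≡_ _≡_ squeeze
  squeeze-injective {x} {y} e = perm (punchOut-injective (λ e′ → miss (x , sym e′)) (λ e′ → miss (y , sym e′)) e)

-- The junk value fromℕ n only arises when σ misses n, which no permutation does.
preimageMax : ∀ {n} → Endo (suc n) → Fin (suc n)
preimageMax {n} σ with any? (λ x → lookup σ x ≟ fromℕ n)
... | yes (x , _) = x
... | no  _       = fromℕ n

lookup-preimageMax : ∀ {n} (σ : Endo (suc n)) → IsPermutation σ → lookup σ (preimageMax σ) ≡ fromℕ n
lookup-preimageMax {n} σ perm with any? (λ x → lookup σ x ≟ fromℕ n)
... | yes (_ , e) = e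
... | no  miss    = ⊥-elim (miss (injective⇒hitsMax σ perm))

-- bypass (σ x) (σ n) x: the image of x once n is cut out of its cycle.
bypass : ∀ {n} → Maybe (Fin n) → Maybe (Fin n) → Fin n → Fin n
bypass (just y) _        _ = y
bypass nothing  (just y) _ = y
bypass nothing  nothing  x = x

restrictedLookup : ∀ {n} → Endo (suc n) → Maybe (Fin n) → Maybe (Fin n)
restrictedLookup σ a = restrict (lookup σ (embed a))

removeMax : ∀ {n} → Endo (suc n) → Endo n
removeMax σ = Vec.tabulate λ x → bypass (restrictedLookup σ (just x)) (restrictedLookup σ nothing) x

split : ∀ {n} → Endo (suc n) → Fin (suc n) × Endo n
split σ = preimageMax σ , removeMax σ

insertAfter-bypass : ∀ {n} (f : Maybe (Fin n) → Maybe (Fin n)) → Injective _≡_ _≡_ f →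
  ∀ mj → f mj ≡ nothing → ∀ a → insertAfter mj (λ x → bypass (f (just x)) (f nothing) x) a ≡ f a
insertAfter-bypass f inj nothing  f↦ nothing  = sym f↦
insertAfter-bypass f inj nothing  f↦ (just x) with f (just x) in e
... | just _  = refl
... | nothing = ⊥-elim (just≢nothing (inj (trans e (sym f↦))))
insertAfter-bypass f inj (just j) f↦ nothing rewrite f↦ with f nothing in e
... | just _  = refl
... | nothing = ⊥-elim (just≢nothing (inj (trans f↦ (sym e))))
insertAfter-bypass f inj (just j) f↦ (just x) with x ≟ j
... | yes refl = sym f↦
... | no  x≢j with f (just x) in e
...   | just _  = refl
...   | nothing = ⊥-elim (x≢j (just-injective (inj (trans e (sym f↦)))))

bypass-insertAfter : ∀ {n} mj (t : Fin n → Fin n) x →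
  bypass (insertAfter mj t (just x)) (insertAfter mj t nothing) x ≡ t x
bypass-insertAfter nothing  t x = refl
bypass-insertAfter (just j) t x with x ≟ j
... | yes refl = refl
... | no  _    = refl

insertMax-split : ∀ {n} (σ : Endo (suc n)) → IsPermutation σ → uncurry insertMax (split σ) ≡ σ
insertMax-split σ perm = lookup-extensionality _ σ λ x → begin
  lookup (insertMax j τ) x
    ≡⟨ cong (lookup (insertMax j τ)) (embed-restrict x) ⟨
  lookup (insertMax j τ) (embed (restrict x))
    ≡⟨ lookup-insertMax j τ (restrict x) ⟩
  embed (insertAfter (restrict j) (lookup τ) (restrict x))
    ≡⟨ cong embed (insertAfter-cong (restrict j) (Vec.lookup∘tabulate _) (restrict x)) ⟩
  embed (insertAfter (restrict j) (λ y → bypass (f (just y)) (f nothing) y) (restrict x))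
    ≡⟨ cong embed (insertAfter-bypass f f-injective (restrict j) f↦ (restrict x)) ⟩
  embed (f (restrict x))
    ≡⟨ embed-restrict _ ⟩
  lookup σ (embed (restrict x))
    ≡⟨ cong (lookup σ) (embed-restrict x) ⟩
  lookup σ x
    ∎
  where
  j = preimageMax σ
  τ = removeMax σ
  f = restrictedLookup σ
  f-injective : Injective _≡_ _≡_ f
  f-injective e = embed-injective (perm (restrict-injective e))
  f↦ : f (restrict j) ≡ nothing
  f↦ = trans (cong (restrict ∘ lookup σ) (embed-restrict j))
             (trans (cong restrict (lookup-preimageMax σ perm)) (restrict-embed nothing))

split-insertMax : ∀ {n} j (τ : Endo n) → IsPermutation (insertMax j τ) → split (insertMax j τ) ≡ (j , τ)
split-insertMax {n} j τ perm = cong₂ _,_ preimage-j removed-τ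
  where
  σ = insertMax j τ
  σj : lookup σ j ≡ fromℕ n
  σj = trans (cong (lookup σ) (sym (embed-restrict j)))
             (trans (lookup-insertMax j τ (restrict j)) (cong embed (insertAfter-self (restrict j) (lookup τ))))
  preimage-j : preimageMax σ ≡ j
  preimage-j = perm (trans (lookup-preimageMax σ perm) (sym σj))
  restrictedLookup-σ : ∀ a → restrictedLookup σ a ≡ insertAfter (restrict j) (lookup τ) a
  restrictedLookup-σ a = trans (cong restrict (lookup-insertMax j τ a)) (restrict-embed _)
  removed-τ : removeMax σ ≡ τ
  removed-τ = lookup-extensionality (removeMax σ) τ λ x → begin
    lookup (removeMax σ) x
      ≡⟨ Vec.lookup∘tabulate _ x ⟩
    bypass (restrictedLookup σ (just x)) (restrictedLookup σ nothing) x
      ≡⟨ cong₂ (λ u v → bypass u v x) (restrictedLookup-σ (just x)) (restrictedLookup-σ nothing) ⟩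
    bypass (insertAfter (restrict j) (lookup τ) (just x)) (insertAfter (restrict j) (lookup τ) nothing) x
      ≡⟨ bypass-insertAfter (restrict j) (lookup τ) x ⟩
    lookup τ x
      ∎

-- Recurrences

rCounted : ℕ → ℕ → ∀ {n} → Endo n → Bool
rCounted r m σ = isPerm σ ∧ (numCycles σ ≡ᵇ m) ∧ firstDistinct r σ

rCounted⇒injective : ∀ {r m n} (σ : Endo n) → T (rCounted r m σ) → IsPermutation σ
rCounted⇒injective σ h = isPerm⇒injective σ (proj₁ (Equivalence.to (T-∧ {isPerm σ}) h))

rCounted⇒DistinctCycles : ∀ {r m n} (σ : Endo n) → T (rCounted r m σ) → DistinctCycles r σ
rCounted⇒DistinctCycles {r} {m} σ h =
  firstDistinct⇒DistinctCycles σ (rCounted⇒injective {r} {m} σ h) r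
    (proj₂ (Equivalence.to (T-∧ {numCycles σ ≡ᵇ m}) (proj₂ (Equivalence.to (T-∧ {isPerm σ}) h))))

_≟ᵖ_ : ∀ {n} → DecidableEquality (Fin (suc n) × Endo n)
_≟ᵖ_ = Product.≡-dec _≟_ _≟ᵛ_

insertionData : ∀ n → List (Fin (suc n) × Endo n)
insertionData n = concatMap (λ j → map (j ,_) (allVecs n n)) (allFin (suc n))

insertionData-enumerates : ∀ {n} → Enumerates _≟ᵖ_ (insertionData n)
insertionData-enumerates {n} = occurring-once λ (j , τ) →
  concatMap-map-enumerates {eqC? = _≟ᵖ_} _,_ Product.,-injective allFin-enumerates (allVecs-enumerates n) j τ

shift : (ℕ → ℕ) → ℕ → ℕ
shift f zero    = 0
shift f (suc m) = f m

shift-cong : ∀ {f g} → (∀ k → f k ≡ g k) → ∀ m → shift f m ≡ shift g m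
shift-cong f≗g zero    = refl
shift-cong f≗g (suc m) = f≗g m

rCounted-insertMax : ∀ {r n} m → r ≤ n → (j : Fin (suc n)) (τ : Endo n) →
  rCounted r m (insertMax j τ) ≡ isPerm τ ∧ (indicator (is-nothing (restrict j)) + numCycles τ ≡ᵇ m) ∧ firstDistinct r τ
rCounted-insertMax {r} m r≤n j τ rewrite isPerm-insertMax j τ with isPerm τ in τ-perm
... | false = refl
... | true  = cong₂ (λ c d → (c ≡ᵇ m) ∧ d) (numCycles-insertMax j τ perm) (firstDistinct-insertMax j τ r r≤n perm)
  where perm = isPerm⇒injective τ (Equivalence.from T-≡ τ-perm)

rStirling1-suc : ∀ {r n} m → r ≤ n → rStirling1 r (suc n) m ≡ n * rStirling1 r n m + shift (rStirling1 r n) m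
rStirling1-suc {r} {n} m r≤n = begin
  rStirling1 r (suc n) m
    ≡⟨ countB-bijection (allVecs-enumerates (suc n)) insertionData-enumerates (rCounted r m) split (uncurry insertMax)
         (λ σ h → insertMax-split σ (rCounted⇒injective {r} {m} σ h))
         (λ (j , τ) h → split-insertMax j τ (rCounted⇒injective {r} {m} (insertMax j τ) h)) ⟩
  countB (rCounted r m ∘ uncurry insertMax) (insertionData n)
    ≡⟨ countB-concatMap-map (rCounted r m ∘ uncurry insertMax) _,_ (allFin (suc n)) (allVecs n n) ⟩
  sum (map (λ j → countB (λ τ → rCounted r m (insertMax j τ)) (allVecs n n)) (allFin (suc n)))
    ≡⟨ cong sum (map-cong (λ j → countB-cong (allVecs n n) (rCounted-insertMax m r≤n j)) (allFin (suc n))) ⟩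
  sum (map (count ∘ extra) (allFin (suc n)))
    ≡⟨ sum-map-allFin-last (count ∘ extra) ⟩
  sum (map (count ∘ extra ∘ inject₁) (allFin n)) + count (extra (fromℕ n))
    ≡⟨ cong₂ _+_ (trans (cong sum (map-cong (λ x → cong (count ∘ indicator ∘ is-nothing) (restrict-embed (just x))) (allFin n)))
                        (sum-map-allFin-const n _))
                 (cong (count ∘ indicator ∘ is-nothing) (restrict-embed {n} nothing)) ⟩
  n * count 0 + count 1
    ≡⟨ cong (n * count 0 +_) (count-new-cycle m) ⟩
  n * rStirling1 r n m + shift (rStirling1 r n) m
    ∎
  where
  extra : Fin (suc n) → ℕ
  extra j = indicator (is-nothing (restrict j))
  countWith : ℕ → ℕ → ℕ
  countWith c m = countB (λ τ → isPerm τ ∧ (c + numCycles τ ≡ᵇ m) ∧ firstDistinct r τ) (allVecs n n)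
  count : ℕ → ℕ
  count c = countWith c m
  count-new-cycle : ∀ m → countWith 1 m ≡ shift (rStirling1 r n) m
  count-new-cycle zero    = countB-false (λ τ → isPerm τ ∧ false ∧ firstDistinct r τ) (allVecs n n) (λ τ → ∧-zeroʳ (isPerm τ))
  count-new-cycle (suc m) = refl

rStirling1-diag : ∀ r m → rStirling1 r r m ≡ indicator (r ≡ᵇ m)
rStirling1-diag r m =
  trans (countB-unique (allVecs-enumerates r) (rCounted r m) (identity r) only-identity) (cong indicator identity-counted)
  where
  only-identity : ∀ σ → T (rCounted r m σ) → σ ≡ identity r
  only-identity σ h = DistinctCycles⇒identity σ (rCounted⇒injective {r} {m} σ h) (rCounted⇒DistinctCycles {r} {m} σ h)
  identity-counted : rCounted r m (identity r) ≡ (r ≡ᵇ m)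
  identity-counted
    rewrite T⇒≡true (injective⇒isPerm (identity r) identity-injective)
          | numCycles-identity r
          | T⇒≡true (DistinctCycles⇒firstDistinct (identity r) r (identity-DistinctCycles r))
    = ∧-identityʳ (r ≡ᵇ m)

stirling1≡rStirling1 : ∀ n m → stirling1 n m ≡ rStirling1 0 n m
stirling1≡rStirling1 n m = countB-cong (allVecs n n) λ σ → begin
  isPerm σ ∧ (numCycles σ ≡ᵇ m)        ≡⟨ cong (isPerm σ ∧_) (∧-identityʳ _) ⟨
  isPerm σ ∧ (numCycles σ ≡ᵇ m) ∧ true ≡⟨ cong (λ b → isPerm σ ∧ (numCycles σ ≡ᵇ m) ∧ b) (T⇒≡true (DistinctCycles⇒firstDistinct σ 0 λ _ _ _ ())) ⟨
  rCounted 0 m σ                       ∎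

stirling1-suc : ∀ n m → stirling1 (suc n) m ≡ n * stirling1 n m + shift (stirling1 n) m
stirling1-suc n m = begin
  stirling1 (suc n) m                                 ≡⟨ stirling1≡rStirling1 (suc n) m ⟩
  rStirling1 0 (suc n) m                              ≡⟨ rStirling1-suc {n = n} m z≤n ⟩
  n * rStirling1 0 n m + shift (rStirling1 0 n) m     ≡⟨ cong₂ (λ u v → n * u + v) (stirling1≡rStirling1 n m)
                                                               (shift-cong (stirling1≡rStirling1 n) m) ⟨
  n * stirling1 n m + shift (stirling1 n) m           ∎

indicator-≢ : ∀ {m n} → m ≢ n → indicator (m ≡ᵇ n) ≡ 0
indicator-≢ {m} {n} m≢n = cong indicator (¬T⇒≡false (m≢n ∘ ≡ᵇ⇒≡ m n))

rStirling1-step : ∀ r d k →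
  rStirling1 r (r + suc d) k ≡ (r + d) * rStirling1 r (r + d) k + shift (rStirling1 r (r + d)) k
rStirling1-step r d k = trans (cong (λ n → rStirling1 r n k) (+-suc r d)) (rStirling1-suc k (m≤m+n r d))

rStirling1-base : ∀ r k → rStirling1 r (r + 0) k ≡ indicator (r ≡ᵇ k)
rStirling1-base r k = trans (cong (λ n → rStirling1 r n k) (+-identityʳ r)) (rStirling1-diag r k)

rStirling1-below : ∀ r d {k} → k < r → rStirling1 r (r + d) k ≡ 0
rStirling1-below r zero    {k} k<r = trans (rStirling1-base r k) (indicator-≢ (λ r≡k → <-irrefl (sym r≡k) k<r))
rStirling1-below r (suc d) {k} k<r =
  trans (rStirling1-step r d k)
        (cong₂ _+_ (trans (cong ((r + d) *_) (rStirling1-below r d k<r)) (*-zeroʳ (r + d))) (shift-below k k<r))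
  where
  shift-below : ∀ k → k < r → shift (rStirling1 r (r + d)) k ≡ 0
  shift-below zero    _   = refl
  shift-below (suc k) k<r = rStirling1-below r d (<-trans (n<1+n k) k<r)

rStirling1-above : ∀ r d {k} → r + d < k → rStirling1 r (r + d) k ≡ 0
rStirling1-above r zero    {k} r+0<k =
  trans (rStirling1-base r k) (indicator-≢ (λ r≡k → <-irrefl r≡k (subst (_< k) (+-identityʳ r) r+0<k)))
rStirling1-above r (suc d) {k} r+d+1<k =
  trans (rStirling1-step r d k)
        (cong₂ _+_ (trans (cong ((r + d) *_) (rStirling1-above r d (<-trans (n<1+n (r + d)) lt))) (*-zeroʳ (r + d)))
                   (shift-above k lt))
  where
  lt : suc (r + d) < k
  lt = subst (_< k) (+-suc r d) r+d+1<k
  shift-above : ∀ k → suc (r + d) < k → shift (rStirling1 r (r + d)) k ≡ 0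
  shift-above (suc k) (s≤s r+d<k) = rStirling1-above r d r+d<k

stirling1-above : ∀ {n m} → n < m → stirling1 n m ≡ 0
stirling1-above {n} {m} n<m = trans (stirling1≡rStirling1 n m) (rStirling1-above 0 n n<m)

stirling1-zero : ∀ {n} → 1 ≤ n → stirling1 n 0 ≡ 0
stirling1-zero {suc zero}    _ = stirling1-suc 0 0
stirling1-zero {suc (suc n)} _ = begin
  stirling1 (suc (suc n)) 0          ≡⟨ stirling1-suc (suc n) 0 ⟩
  suc n * stirling1 (suc n) 0 + 0    ≡⟨ +-identityʳ _ ⟩
  suc n * stirling1 (suc n) 0        ≡⟨ cong (suc n *_) (stirling1-zero {suc n} (s≤s z≤n)) ⟩
  suc n * 0                          ≡⟨ *-zeroʳ (suc n) ⟩
  0                                  ∎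

-- Convolution

infixl 7 _⋆_
_⋆_ : (ℕ → ℕ) → (ℕ → ℕ) → ℕ → ℕ
(a ⋆ b) zero    = a 0 * b 0
(a ⋆ b) (suc m) = a 0 * b (suc m) + ((a ∘ suc) ⋆ b) m

⋆-congʳ : ∀ a {b c} → (∀ k → b k ≡ c k) → ∀ m → (a ⋆ b) m ≡ (a ⋆ c) m
⋆-congʳ a b≗c zero    = cong (a 0 *_) (b≗c 0)
⋆-congʳ a b≗c (suc m) = cong₂ _+_ (cong (a 0 *_) (b≗c (suc m))) (⋆-congʳ (a ∘ suc) b≗c m)

⋆-linearʳ : ∀ a c b b′ m → (a ⋆ (λ k → c * b k + b′ k)) m ≡ c * (a ⋆ b) m + (a ⋆ b′) m
⋆-linearʳ a c b b′ zero =
  solve 4 (λ x c y z → x :* (c :* y :+ z) := c :* (x :* y) :+ x :* z) refl (a 0) c (b 0) (b′ 0)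
⋆-linearʳ a c b b′ (suc m) = begin
  a 0 * (c * b (suc m) + b′ (suc m)) + ((a ∘ suc) ⋆ (λ k → c * b k + b′ k)) m
    ≡⟨ cong (a 0 * (c * b (suc m) + b′ (suc m)) +_) (⋆-linearʳ (a ∘ suc) c b b′ m) ⟩
  a 0 * (c * b (suc m) + b′ (suc m)) + (c * ((a ∘ suc) ⋆ b) m + ((a ∘ suc) ⋆ b′) m)
    ≡⟨ solve 6 (λ x c y z u v → x :* (c :* y :+ z) :+ (c :* u :+ v) := c :* (x :* y :+ u) :+ (x :* z :+ v))
         refl (a 0) c (b (suc m)) (b′ (suc m)) (((a ∘ suc) ⋆ b) m) (((a ∘ suc) ⋆ b′) m) ⟩
  c * (a ⋆ b) (suc m) + (a ⋆ b′) (suc m)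
    ∎

⋆-shiftʳ : ∀ a b m → (a ⋆ shift b) m ≡ shift (a ⋆ b) m
⋆-shiftʳ a b zero          = *-zeroʳ (a 0)
⋆-shiftʳ a b (suc zero)    = trans (cong (a 0 * b 0 +_) (*-zeroʳ (a 1))) (+-identityʳ _)
⋆-shiftʳ a b (suc (suc m)) = cong (a 0 * b (suc m) +_) (⋆-shiftʳ (a ∘ suc) b (suc m))

⋆-unitʳ : ∀ a m → (a ⋆ (λ k → indicator (k ≡ᵇ 0))) m ≡ a m
⋆-unitʳ a zero    = *-identityʳ (a 0)
⋆-unitʳ a (suc m) = trans (cong (_+ ((a ∘ suc) ⋆ (λ k → indicator (k ≡ᵇ 0))) m) (*-zeroʳ (a 0))) (⋆-unitʳ (a ∘ suc) m)

shiftedRStirling1 : ℕ → ℕ → ℕ → ℕ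
shiftedRStirling1 r d k = rStirling1 r (r + d) (k + r)

shiftedRStirling1-zero : ∀ r k → shiftedRStirling1 r 0 k ≡ indicator (k ≡ᵇ 0)
shiftedRStirling1-zero r zero    = trans (rStirling1-base r r) (cong indicator (T⇒≡true (≡⇒≡ᵇ r r refl)))
shiftedRStirling1-zero r (suc k) = trans (rStirling1-base r (suc k + r)) (indicator-≢ (m≢1+n+m r))

shiftedRStirling1-suc : ∀ r d k →
  shiftedRStirling1 r (suc d) k ≡ (r + d) * shiftedRStirling1 r d k + shift (shiftedRStirling1 r d) k
shiftedRStirling1-suc r d zero    = trans (rStirling1-step r d r) (cong ((r + d) * shiftedRStirling1 r d 0 +_) (shift-below r ≤-refl))
  where
  shift-below : ∀ k → k ≤ r → shift (rStirling1 r (r + d)) k ≡ 0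
  shift-below zero    _   = refl
  shift-below (suc k) k<r = rStirling1-below r d k<r
shiftedRStirling1-suc r d (suc k) = rStirling1-step r d (suc k + r)

-- Both sides satisfy the recurrence of stirling1 in d, by linearity of ⋆ and its commuting with shift.
convolution-identity : ∀ r d m → (stirling1 r ⋆ shiftedRStirling1 r d) m ≡ stirling1 (r + d) m
convolution-identity r zero m = begin
  (stirling1 r ⋆ shiftedRStirling1 r 0) m           ≡⟨ ⋆-congʳ (stirling1 r) (shiftedRStirling1-zero r) m ⟩
  (stirling1 r ⋆ (λ k → indicator (k ≡ᵇ 0))) m     ≡⟨ ⋆-unitʳ (stirling1 r) m ⟩
  stirling1 r m                                     ≡⟨ cong (λ n → stirling1 n m) (+-identityʳ r) ⟨
  stirling1 (r + 0) m                               ∎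
convolution-identity r (suc d) m = begin
  (S ⋆ R (suc d)) m                                        ≡⟨ ⋆-congʳ S (shiftedRStirling1-suc r d) m ⟩
  (S ⋆ (λ k → (r + d) * R d k + shift (R d) k)) m          ≡⟨ ⋆-linearʳ S (r + d) (R d) (shift (R d)) m ⟩
  (r + d) * (S ⋆ R d) m + (S ⋆ shift (R d)) m              ≡⟨ cong ((r + d) * (S ⋆ R d) m +_) (⋆-shiftʳ S (R d) m) ⟩
  (r + d) * (S ⋆ R d) m + shift (S ⋆ R d) m                ≡⟨ cong₂ _+_ (cong ((r + d) *_) (convolution-identity r d m))
                                                                        (shift-cong (convolution-identity r d) m) ⟩
  (r + d) * stirling1 (r + d) m + shift (stirling1 (r + d)) m ≡⟨ stirling1-suc (r + d) m ⟨
  stirling1 (suc (r + d)) m                                ≡⟨ cong (λ n → stirling1 n m) (+-suc r d) ⟨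
  stirling1 (r + suc d) m                                  ∎
  where
  S = stirling1 r
  R = shiftedRStirling1 r

sumBelow : ℕ → (ℕ → ℕ) → ℕ
sumBelow zero    h = 0
sumBelow (suc u) h = h 0 + sumBelow u (h ∘ suc)

sum-map-applyUpTo : ∀ (h g : ℕ → ℕ) u → sum (map h (applyUpTo g u)) ≡ sumBelow u (h ∘ g)
sum-map-applyUpTo h g zero    = refl
sum-map-applyUpTo h g (suc u) = cong (h (g 0) +_) (sum-map-applyUpTo h (g ∘ suc) u)

sumFrom1≡sumBelow : ∀ u f → sumFrom1 u f ≡ sumBelow u (f ∘ suc)
sumFrom1≡sumBelow u f = sum-map-applyUpTo (f ∘ suc) id u

⋆≡sumBelow : ∀ a b m → (a ⋆ b) m ≡ sumBelow (suc m) (λ ℓ → a ℓ * b (m ∸ ℓ))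
⋆≡sumBelow a b zero    = sym (+-identityʳ _)
⋆≡sumBelow a b (suc m) = cong (a 0 * b (suc m) +_) (⋆≡sumBelow (a ∘ suc) b m)

sumBelow-cong : ∀ u {h h′} → (∀ i → i < u → h i ≡ h′ i) → sumBelow u h ≡ sumBelow u h′
sumBelow-cong zero    _    = refl
sumBelow-cong (suc u) h≗h′ = cong₂ _+_ (h≗h′ 0 z<s) (sumBelow-cong u (λ i i<u → h≗h′ (suc i) (s<s i<u)))

sumBelow-zero : ∀ u h → (∀ i → i < u → h i ≡ 0) → sumBelow u h ≡ 0
sumBelow-zero zero    h _     = refl
sumBelow-zero (suc u) h h≡0 = cong₂ _+_ (h≡0 0 z<s) (sumBelow-zero u (h ∘ suc) (λ i i<u → h≡0 (suc i) (s<s i<u)))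

sumBelow-+ : ∀ a b h → sumBelow (a + b) h ≡ sumBelow a h + sumBelow b (λ i → h (a + i))
sumBelow-+ zero    b h = refl
sumBelow-+ (suc a) b h = trans (cong (h 0 +_) (sumBelow-+ a b (h ∘ suc))) (sym (+-assoc (h 0) _ _))

sumBelow-window : ∀ N a u h → a + u ≤ N → (∀ ℓ → ℓ < a → h ℓ ≡ 0) → (∀ ℓ → a + u ≤ ℓ → ℓ < N → h ℓ ≡ 0) →
  sumBelow N h ≡ sumBelow u (λ i → h (a + i))
sumBelow-window N a u h a+u≤N below above = begin
  sumBelow N h
    ≡⟨ cong (λ N → sumBelow N h) (m+[n∸m]≡n a+u≤N) ⟨
  sumBelow (a + u + (N ∸ (a + u))) h
    ≡⟨ sumBelow-+ (a + u) _ h ⟩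
  sumBelow (a + u) h + sumBelow (N ∸ (a + u)) (λ i → h (a + u + i))
    ≡⟨ cong₂ _+_ (sumBelow-+ a u h) (sumBelow-zero _ _ λ i i<N∸[a+u] → above _ (m≤m+n (a + u) i) (top i i<N∸[a+u])) ⟩
  sumBelow a h + sumBelow u (λ i → h (a + i)) + 0
    ≡⟨ +-identityʳ _ ⟩
  sumBelow a h + sumBelow u (λ i → h (a + i))
    ≡⟨ cong (_+ sumBelow u (λ i → h (a + i))) (sumBelow-zero a h below) ⟩
  sumBelow u (λ i → h (a + i))
    ∎
  where
  top : ∀ i → i < N ∸ (a + u) → a + u + i < N
  top i i<N∸[a+u] = subst (a + u + i <_) (m+[n∸m]≡n a+u≤N) (+-monoʳ-< (a + u) i<N∸[a+u])

convolution-window : ∀ r d m a u → a + u ≤ suc m →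
  (∀ ℓ → ℓ < a → stirling1 r ℓ * shiftedRStirling1 r d (m ∸ ℓ) ≡ 0) →
  (∀ ℓ → a + u ≤ ℓ → ℓ ≤ m → stirling1 r ℓ * shiftedRStirling1 r d (m ∸ ℓ) ≡ 0) →
  sumBelow u (λ i → stirling1 r (a + i) * shiftedRStirling1 r d (m ∸ (a + i))) ≡ stirling1 (r + d) m
convolution-window r d m a u a+u≤ below above = begin
  sumBelow u (λ i → term (a + i))         ≡⟨ sumBelow-window (suc m) a u term a+u≤ below (λ ℓ a+u≤ℓ ℓ<m+1 → above ℓ a+u≤ℓ (s≤s⁻¹ ℓ<m+1)) ⟨
  sumBelow (suc m) term                   ≡⟨ ⋆≡sumBelow (stirling1 r) (shiftedRStirling1 r d) m ⟨
  (stirling1 r ⋆ shiftedRStirling1 r d) m ≡⟨ convolution-identity r d m ⟩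
  stirling1 (r + d) m                     ∎
  where
  term : ℕ → ℕ
  term ℓ = stirling1 r ℓ * shiftedRStirling1 r d (m ∸ ℓ)

sum-identity₁ : ∀ {n r} m → 1 ≤ r → r ≤ n →
  sumFrom1 m (λ ℓ → stirling1 r ℓ * rStirling1 r n (r + m ∸ ℓ)) ≡ stirling1 n m
sum-identity₁ {r = r} m 1≤r r≤n with d , refl ← m≤n⇒∃[o]m+o≡n r≤n = begin
  sumFrom1 m term                                                  ≡⟨ sumFrom1≡sumBelow m term ⟩
  sumBelow m (term ∘ suc)                                          ≡⟨ sumBelow-cong m reindex ⟩
  sumBelow m (λ i → stirling1 r (1 + i) * shiftedRStirling1 r d (m ∸ (1 + i)))
    ≡⟨ convolution-window r d m 1 m ≤-refl below (λ ℓ m<ℓ ℓ≤m → ⊥-elim (<⇒≱ m<ℓ ℓ≤m)) ⟩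
  stirling1 (r + d) m                                              ∎
  where
  term : ℕ → ℕ
  term ℓ = stirling1 r ℓ * rStirling1 r (r + d) (r + m ∸ ℓ)
  reindex : ∀ i → i < m → term (suc i) ≡ stirling1 r (1 + i) * shiftedRStirling1 r d (m ∸ (1 + i))
  reindex i i<m = cong (λ k → stirling1 r (suc i) * rStirling1 r (r + d) k) (trans (+-∸-assoc r i<m) (+-comm r _))
  below : ∀ ℓ → ℓ < 1 → stirling1 r ℓ * shiftedRStirling1 r d (m ∸ ℓ) ≡ 0
  below zero _ = cong (_* shiftedRStirling1 r d m) (stirling1-zero 1≤r)
  below (suc _) (s≤s ())

m⊓n<o≤m⇒n<o : ∀ {m n o} → m ⊓ n < o → o ≤ m → n < o
m⊓n<o≤m⇒n<o {m} {n} m⊓n<o o≤m with ≤-total m n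
... | inj₁ m≤n = ⊥-elim (<⇒≱ (subst (_< _) (m≤n⇒m⊓n≡m m≤n) m⊓n<o) o≤m)
... | inj₂ n≤m = subst (_< _) (m≥n⇒m⊓n≡n n≤m) m⊓n<o

1+r+d∸r≡1+d : ∀ r d → suc (r + d) ∸ r ≡ suc d
1+r+d∸r≡1+d r d = trans (cong (_∸ r) (sym (+-suc r d))) (m+n∸m≡n r (suc d))

2+r+d∸r≡2+d : ∀ r d → suc (suc (r + d)) ∸ r ≡ suc (suc d)
2+r+d∸r≡2+d r d = trans (cong (λ x → suc x ∸ r) (sym (+-suc r d))) (1+r+d∸r≡1+d r (suc d))

-- The second sum runs over ℓ from e + 1 to m ⊓ r.
window-top : ∀ r d e → e ≤ r → e + (suc (r + d) ∸ ((suc d + e) ⊔ r)) ≡ (suc d + e) ⊓ r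
window-top r d e e≤r with ≤-total (suc d + e) r
... | inj₁ m≤r = begin
  e + (suc (r + d) ∸ ((suc d + e) ⊔ r)) ≡⟨ cong (λ x → e + (suc (r + d) ∸ x)) (m≤n⇒m⊔n≡n m≤r) ⟩
  e + (suc (r + d) ∸ r)                 ≡⟨ cong (e +_) (1+r+d∸r≡1+d r d) ⟩
  e + suc d                             ≡⟨ +-comm e (suc d) ⟩
  suc d + e                             ≡⟨ m≤n⇒m⊓n≡m m≤r ⟨
  (suc d + e) ⊓ r                       ∎
... | inj₂ r≤m = begin
  e + (suc (r + d) ∸ ((suc d + e) ⊔ r)) ≡⟨ cong (λ x → e + (suc (r + d) ∸ x)) (m≥n⇒m⊔n≡m r≤m) ⟩
  e + (r + d ∸ (d + e))                 ≡⟨ cong (λ x → e + (x ∸ (d + e))) (+-comm r d) ⟩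
  e + (d + r ∸ (d + e))                 ≡⟨ cong (e +_) ([m+n]∸[m+o]≡n∸o d r e) ⟩
  e + (r ∸ e)                           ≡⟨ m+[n∸m]≡n e≤r ⟩
  r                                     ≡⟨ m≥n⇒m⊓n≡n r≤m ⟨
  (suc d + e) ⊓ r                       ∎

sum-identity₂ : ∀ {n r} m → r ≤ n → suc (suc n) ∸ r ≤ m → m ≤ n →
  sumFrom1 (suc n ∸ (m ⊔ r)) (λ ℓ → stirling1 r ((m + r ∸ suc n) + ℓ) * rStirling1 r n (suc n ∸ ℓ)) ≡ stirling1 n m
sum-identity₂ {r = r} m r≤n lo hi with d , refl ← m≤n⇒∃[o]m+o≡n r≤n
  with e , refl ← m≤n⇒∃[o]m+o≡n (≤-trans (n≤1+n (suc d)) (subst (_≤ m) (2+r+d∸r≡2+d r d) lo)) = begin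
  sumFrom1 u term                ≡⟨ sumFrom1≡sumBelow u term ⟩
  sumBelow u (term ∘ suc)        ≡⟨ sumBelow-cong u reindex ⟩
  sumBelow u (λ i → stirling1 r (suc e + i) * shiftedRStirling1 r d (m ∸ (suc e + i)))
    ≡⟨ convolution-window r d m (suc e) u fits below above ⟩
  stirling1 (r + d) m            ∎
  where
  u = suc (r + d) ∸ (m ⊔ r)
  term : ℕ → ℕ
  term ℓ = stirling1 r ((m + r ∸ suc (r + d)) + ℓ) * rStirling1 r (r + d) (suc (r + d) ∸ ℓ)
  u≤d+1 : u ≤ suc d
  u≤d+1 = ≤-trans (∸-monoʳ-≤ (suc (r + d)) (m≤n⊔m m r)) (≤-reflexive (1+r+d∸r≡1+d r d))
  e≤r : e ≤ r
  e≤r = +-cancelʳ-≤ d e r (≤-trans (≤-reflexive (+-comm e d)) (≤-trans (n≤1+n (d + e)) hi))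
  excess : m + r ∸ suc (r + d) ≡ e
  excess = trans (cong (_∸ suc (r + d)) (solve 3 (λ d e r → con 1 :+ d :+ e :+ r := e :+ (con 1 :+ (r :+ d))) refl d e r))
                 (m+n∸n≡m e (suc (r + d)))
  old-index : ∀ i → i ≤ d → suc (r + d) ∸ suc i ≡ (m ∸ (suc e + i)) + r
  old-index i i≤d = begin
    r + d ∸ i              ≡⟨ +-∸-assoc r i≤d ⟩
    r + (d ∸ i)            ≡⟨ +-comm r _ ⟩
    d ∸ i + r              ≡⟨ cong (_+ r) ([m+n]∸[m+o]≡n∸o e d i) ⟨
    e + d ∸ (e + i) + r    ≡⟨ cong (λ x → x ∸ (e + i) + r) (+-comm e d) ⟩
    d + e ∸ (e + i) + r    ∎
  reindex : ∀ i → i < u → term (suc i) ≡ stirling1 r (suc e + i) * shiftedRStirling1 r d (m ∸ (suc e + i))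
  reindex i i<u = cong₂ _*_ (cong (stirling1 r) (trans (cong (_+ suc i) excess) (+-suc e i)))
                            (cong (rStirling1 r (r + d)) (old-index i (s≤s⁻¹ (<-≤-trans i<u u≤d+1))))
  fits : suc e + u ≤ suc m
  fits = s≤s (≤-trans (+-monoʳ-≤ e u≤d+1) (≤-reflexive (+-comm e (suc d))))
  below : ∀ ℓ → ℓ < suc e → stirling1 r ℓ * shiftedRStirling1 r d (m ∸ ℓ) ≡ 0
  below ℓ ℓ≤e = trans (cong (stirling1 r ℓ *_) (rStirling1-above r d (subst (_< m ∸ ℓ + r) (+-comm d r) (+-monoˡ-< r d<m∸ℓ))))
                      (*-zeroʳ (stirling1 r ℓ))
    where
    d<m∸ℓ : d < m ∸ ℓ
    d<m∸ℓ = subst (_≤ m ∸ ℓ) (m+n∸n≡m (suc d) e) (∸-monoʳ-≤ m (s≤s⁻¹ ℓ≤e))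
  above : ∀ ℓ → suc e + u ≤ ℓ → ℓ ≤ m → stirling1 r ℓ * shiftedRStirling1 r d (m ∸ ℓ) ≡ 0
  above ℓ top<ℓ ℓ≤m = cong (_* shiftedRStirling1 r d (m ∸ ℓ)) (stirling1-above (m⊓n<o≤m⇒n<o (subst (_< ℓ) (window-top r d e e≤r) top<ℓ) ℓ≤m))

lemma1 : (n r : ℕ) → 1 ≤ n → 1 ≤ r → r ≤ n →
    ((m : ℕ) → 1 ≤ m → m ≤ suc n ∸ r →
      sumFrom1 m (λ ℓ → stirling1 r ℓ * rStirling1 r n (r + m ∸ ℓ)) ≡ stirling1 n m)
    × ((m : ℕ) → suc (suc n) ∸ r ≤ m → m ≤ n →
      sumFrom1 (suc n ∸ (m ⊔ r))
        (λ ℓ → stirling1 r ((m + r ∸ suc n) + ℓ) * rStirling1 r n (suc n ∸ ℓ)) ≡ stirling1 n m)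
lemma1 n r _ 1≤r r≤n = (λ m _ _ → sum-identity₁ m 1≤r r≤n) , (λ m → sum-identity₂ m r≤n)
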